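{- Let $R$ be a commutative ring and $M_n(R)$ the ring of $n\times n$ matrices over $R$. Let $\{N_1,\dots,N_k\}$ be a collection of ideals of $R$ satisfying the CNC-condition, and let $s_i$ be the characteristic of $N_i$ in $N_{i+1}$ ($i=1,\dots,k-1$). Then: (1) If $w$ is a natural number with $\bar x^{\,w}=\bar 1$ for all $\bar x\in (M_n(R/N_1))^*$, then $x^{w s_1\cdots s_{k-1}}=1$ for all $x\in (M_n(R))^*$. (2) If $(M_n(R/N_1))^*$ is finite, then $x^{|(M_n(R/N_1))^*|\, s_1\cdots s_{k-1}}=1$ for all $x\in (M_n(R))^*$. (3) If $(M_n(R))^*$ is finite, then $x^{|(M_n(R/N_1))^*|\,|N_1|^{n^2}}=1$ for all $x\in (M_n(R))^*$.
   Context: Rings have identity; $S^*$ denotes the group of units of a ring $S$. A collection $\{N_1,\dots,N_k\}$ of ideals of $R$ satisfies the CNC-condition if: (i) $\{0\}=N_k\subset N_{k-1}\subset\cdots\subset N_1\subset R$; (ii) for each $i=1,\dots,k-1$ there is $t_i\ge 2$ with $N_i^{t_i}\subset N_{i+1}$ (the minimal such $t_i$ is the nilpotency index of $N_i$ in $N_{i+1}$); (iii) for each $i=1,\dots,k-1$ there is $s_i\ge 1$ with $s_iN_i\subset N_{i+1}$ and all prime factors of $s_i$ are $\ge t_i$; the minimal such $s_i$ is called the characteristic of $N_i$ in $N_{i+1}$. -}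

module Defs where

open import Level using (Level; _⊔_) renaming (suc to lsuc)
open import Algebra.Bundles using (CommutativeRing)
open import Data.Nat as ℕ using (ℕ; zero; suc; _≤_; _<_; _∸_)
open import Data.Nat.Divisibility using (_∣_)
open import Data.Nat.Primality using (Prime)
open import Data.Fin as Fin using (Fin)
open import Data.Vec using (Vec; []; _∷_; foldr)
open import Data.Vec.Relation.Unary.All using (All)
open import Data.Product using (Σ; _×_; ∃; _,_; proj₁)
open import Relation.Nullary using (yes; no)
open import Relation.Binary.PropositionalEquality using (_≡_)

prod1to : (ℕ → ℕ) → ℕ → ℕ
prod1to s zero    = 1
prod1to s (suc m) = prod1to s m ℕ.* s (suc m)

HasCard : ∀ {a r} (A : Set a) (_~_ : A → A → Set r) → ℕ → Set (a ⊔ r)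
HasCard A _~_ m =
  Σ (Fin m → A) λ f →
    (∀ i j → f i ~ f j → i ≡ j) × (∀ x → ∃ λ i → f i ~ x)

module RingDefs {c ℓ} (R : CommutativeRing c ℓ) where
  open CommutativeRing R

  record Ideal (p : Level) : Set (c ⊔ ℓ ⊔ lsuc p) where
    field
      mem  : Carrier → Set p
      resp : ∀ {x y} → x ≈ y → mem x → mem y
      0∈   : mem 0#
      +∈   : ∀ {x y} → mem x → mem y → mem (x + y)
      -∈   : ∀ {x} → mem x → mem (- x)
      *∈   : ∀ r {x} → mem x → mem (r * x)
  open Ideal public

  _⊆I_ : ∀ {p q} → Ideal p → Ideal q → Set (c ⊔ p ⊔ q)
  I ⊆I J = ∀ x → mem I x → mem J x

  _·_ : ℕ → Carrier → Carrier
  zero  · x = 0#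
  suc m · x = x + (m · x)

  vprod : ∀ {t} → Vec Carrier t → Carrier
  vprod = foldr _ _*_ 1#

  data InPow {p} (I : Ideal p) (t : ℕ) : Carrier → Set (c ⊔ ℓ ⊔ p) where
    prod : (xs : Vec Carrier t) → All (mem I) xs → InPow I t (vprod xs)
    zer  : InPow I t 0#
    add  : ∀ {x y} → InPow I t x → InPow I t y → InPow I t (x + y)
    mul  : ∀ r {x} → InPow I t x → InPow I t (r * x)
    rsp  : ∀ {x y} → x ≈ y → InPow I t x → InPow I t y

  IsNilIndex : ∀ {p q} → Ideal p → Ideal q → ℕ → Set (c ⊔ ℓ ⊔ p ⊔ q)
  IsNilIndex I J t =
    2 ≤ t × (∀ x → InPow I t x → mem J x)
      × (∀ t′ → 2 ≤ t′ → (∀ x → InPow I t′ x → mem J x) → t ≤ t′)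

  CharCond : ∀ {p q} → Ideal p → Ideal q → ℕ → ℕ → Set (c ⊔ p ⊔ q)
  CharCond I J t s =
    1 ≤ s × (∀ x → mem I x → mem J (s · x))
      × (∀ p → Prime p → p ∣ s → t ≤ p)

  IsChar : ∀ {p q} → Ideal p → Ideal q → ℕ → ℕ → Set (c ⊔ p ⊔ q)
  IsChar I J t s = CharCond I J t s × (∀ s′ → CharCond I J t s′ → s ≤ s′)

  Mat : ℕ → Set c
  Mat n = Fin n → Fin n → Carrier

  ∑ : ∀ {n} → (Fin n → Carrier) → Carrier
  ∑ {zero}  f = 0#
  ∑ {suc n} f = f Fin.zero + ∑ (λ i → f (Fin.suc i))

  _⊗_ : ∀ {n} → Mat n → Mat n → Mat n
  (A ⊗ B) i j = ∑ λ k → A i k * B k j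

  𝟙 : ∀ {n} → Mat n
  𝟙 i j with i Fin.≟ j
  ... | yes _ = 1#
  ... | no  _ = 0#

  _^ᴹ_ : ∀ {n} → Mat n → ℕ → Mat n
  A ^ᴹ zero  = 𝟙
  A ^ᴹ suc m = A ⊗ (A ^ᴹ m)

  _≈ᴹ_ : ∀ {n} → Mat n → Mat n → Set ℓ
  A ≈ᴹ B = ∀ i j → A i j ≈ B i j

  -- equality in M_n(R/I) ≅ M_n(R)/M_n(I): entrywise congruence modulo I
  _≡ᴹ[_]_ : ∀ {n p} → Mat n → Ideal p → Mat n → Set p
  A ≡ᴹ[ I ] B = ∀ i j → mem I (A i j + - B i j)

  IsUnit : ∀ {n} → Mat n → Set (c ⊔ ℓ)
  IsUnit A = Σ _ λ B → (A ⊗ B) ≈ᴹ 𝟙 × (B ⊗ A) ≈ᴹ 𝟙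

  -- units of M_n(R/I), represented by matrices over R
  IsUnitMod : ∀ {n p} → Ideal p → Mat n → Set (c ⊔ p)
  IsUnitMod I A = Σ _ λ B → (A ⊗ B) ≡ᴹ[ I ] 𝟙 × (B ⊗ A) ≡ᴹ[ I ] 𝟙

  Units : ℕ → Set (c ⊔ ℓ)
  Units n = Σ (Mat n) IsUnit

  _≈U_ : ∀ {n} → Units n → Units n → Set ℓ
  x ≈U y = proj₁ x ≈ᴹ proj₁ y

  UnitsMod : ∀ {p} → ℕ → Ideal p → Set (c ⊔ p)
  UnitsMod n I = Σ (Mat n) (IsUnitMod I)

  UEq : ∀ {n p} (I : Ideal p) → UnitsMod n I → UnitsMod n I → Set p
  UEq I x y = proj₁ x ≡ᴹ[ I ] proj₁ y

  Elems : ∀ {p} → Ideal p → Set (c ⊔ p)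
  Elems I = Σ Carrier (mem I)

  _≈E_ : ∀ {p} {I : Ideal p} → Elems I → Elems I → Set ℓ
  x ≈E y = proj₁ x ≈ proj₁ y

  IsZero : Carrier → Set ℓ
  IsZero x = x ≈ 0#

{-# OPTIONS --safe #-}
module Submission where

-- One layer of the filtration at a time: if X ≡ 1 mod Nᵢ, write X = 1 + Y with Y ∈ Mₙ(Nᵢ) and
-- expand (1 + Y)^sᵢ binomially.  For 1 ≤ l < tᵢ every prime factor of sᵢ exceeds l, so sᵢ divides
-- (sᵢ choose l) and the l-th term lies in sᵢ·Mₙ(Nᵢ) ⊆ Mₙ(Nᵢ₊₁); for l ≥ tᵢ it lies in
-- Mₙ(Nᵢ^tᵢ) ⊆ Mₙ(Nᵢ₊₁).  Hence X^sᵢ ≡ 1 mod Nᵢ₊₁, and climbing to Nₖ = 0 gives (1).  Lagrange's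
-- theorem in Mₙ(R/N₁)^* turns (1) into (2).  For (3), A^|Mₙ(R/N₁)^*| lies in the kernel of
-- Mₙ(R)^* → Mₙ(R/N₁)^*.  Every 1 + Y with Y ∈ Mₙ(N₁) is a unit, since the same climb makes a
-- power of it equal to 1, so the kernel has exactly |N₁|^(n²) elements and Lagrange applies again.
--
-- Lagrange's theorem g^|G| = 1 is proved by counting: multiplication by g permutes G in cycles
-- that all have length ord g.

open import Level using (_⊔_)
open import Algebra.Bundles using (CommutativeRing; Group; Ring)
open import Data.Fin.Base using (Fin; zero; suc; toℕ; combine; funToFin; finToFun)
open import Data.Fin.Properties using (funToFin-finToFin; finToFun-funToFin)
import Data.Nat.Base as ℕ
import Data.Nat.Properties as ℕ
open import Data.Nat.Base using (ℕ; zero; suc; _≤_; _<_; s≤s; z≤n)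
open import Data.Product.Base using (Σ; ∃; _×_; _,_; proj₁; proj₂)
open import Data.Vec.Functional.Relation.Binary.Pointwise using (Pointwise)
open import Function.Base using (_∘_)
open import Relation.Binary.Bundles using (Setoid)
open import Relation.Binary.Core using (Rel)
open import Relation.Binary.PropositionalEquality as ≡ using (_≡_; _≢_)

open import Defs

module Combinatorics where
  open import Data.Bool.Base using (Bool; true; false; _∧_; _∨_; not; if_then_else_)
  open import Data.Bool.Properties using (∧-zeroʳ)
  open import Data.Fin.Base using (fromℕ<)
  open import Data.Fin.Properties using (_≟_; any?; toℕ<n; toℕ-fromℕ<)
  open import Data.List.Base using ([]; _∷_)
  open import Data.List.Relation.Unary.All using (_∷_)
  open import Data.Nat.Base using (_+_; _*_; _∸_; NonZero; >-nonZero⁻¹; ≢-nonZero; pred)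
  open import Data.Nat.Combinatorics using (_C_; nC1≡n; nCk+nC[k+1]≡[n+1]C[k+1])
  open import Data.Nat.Coprimality using (Coprime; coprime-divisor)
  open import Data.Nat.Divisibility using (_∣_; _∣0; ∣-refl; ∣-trans; ∣⇒≤; m∣m*n; 0∣⇒≡0; ∣m∣n⇒∣m+n)
  open import Data.Nat.DivMod using (_%_; _/_; m≡m%n+[m/n]*n; m%n<n)
  open import Data.Nat.GeneralisedArithmetic using (fold; fold-+)
  open import Data.Nat.Induction using (<-rec)
  open import Data.Nat.Primality using (Prime)
  open import Data.Nat.Primality.Factorisation using (factorise)
  open import Data.Nat.Tactic.RingSolver using (solve-∀)
  open import Relation.Binary.PropositionalEquality
    using (refl; sym; trans; cong; cong₂; subst; module ≡-Reasoning)
  open import Relation.Nullary.Decidable using (yes; no; does)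
  open import Relation.Nullary.Negation using (¬_; contradiction)
  open import Relation.Unary using (Pred; Decidable)

  count : ∀ {m} → (Fin m → Bool) → ℕ
  count {zero}  P = 0
  count {suc m} P = (if P zero then 1 else 0) + count (P ∘ suc)

  count-cong : ∀ {m} {P Q : Fin m → Bool} → (∀ x → P x ≡ Q x) → count P ≡ count Q
  count-cong {zero}  P≗Q = refl
  count-cong {suc m} P≗Q =
    cong₂ (λ b n → (if b then 1 else 0) + n) (P≗Q zero) (count-cong (P≗Q ∘ suc))

  count-const-false : ∀ m → count {m} (λ _ → false) ≡ 0
  count-const-false zero    = refl
  count-const-false (suc m) = count-const-false m

  count-const-true : ∀ m → count {m} (λ _ → true) ≡ m
  count-const-true zero    = refl
  count-const-true (suc m) = cong suc (count-const-true m)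

  count-partition : ∀ {m} (P Q : Fin m → Bool) →
    count P ≡ count (λ x → P x ∧ Q x) + count (λ x → P x ∧ not (Q x))
  count-partition {zero}  P Q = refl
  count-partition {suc m} P Q with P zero | Q zero | count-partition (P ∘ suc) (Q ∘ suc)
  ... | false | _     | split = split
  ... | true  | true  | split = cong suc split
  ... | true  | false | split = trans (cong suc split) (sym (ℕ.+-suc _ _))

  count≢0⇒∃ : ∀ {m} (P : Fin m → Bool) → count P ≢ 0 → ∃ λ x → P x ≡ true
  count≢0⇒∃ {zero}  P count≢0 = contradiction refl count≢0
  count≢0⇒∃ {suc m} P count≢0 with P zero in P0≡true
  ... | true  = zero , P0≡true
  ... | false with count≢0⇒∃ (P ∘ suc) count≢0
  ...   | x , Px≡true = suc x , Px≡true

  count-insert : ∀ {m} (a : Fin m) (P : Fin m → Bool) → P a ≡ false →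
    count (λ x → does (a ≟ x) ∨ P x) ≡ suc (count P)
  count-insert zero    P Pa≡false rewrite Pa≡false = refl
  count-insert (suc a) P Pa≡false =
    trans (cong ((if P zero then 1 else 0) +_) (count-insert a (P ∘ suc) Pa≡false)) (ℕ.+-suc _ _)

  bool-ext : ∀ {a b : Bool} → (a ≡ true → b ≡ true) → (b ≡ true → a ≡ true) → a ≡ b
  bool-ext {false} {false} _   _   = refl
  bool-ext {false} {true}  _   b⇒a = b⇒a refl
  bool-ext {true}  {false} a⇒b _   = sym (a⇒b refl)
  bool-ext {true}  {true}  _   _   = refl

  least-witness : ∀ {p} {P : Pred ℕ p} → Decidable P → ∀ {n} → P n →
    ∃ λ d → P d × (∀ {j} → j < d → ¬ P j)
  least-witness {p} {P} P? {n} = <-rec Least search n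
    where
    Least : ℕ → Set p
    Least n = P n → ∃ λ d → P d × (∀ {j} → j < d → ¬ P j)
    search : ∀ n → (∀ {k} → k < n → Least k) → Least n
    search n below Pn with any? (λ (j : Fin n) → P? (toℕ j))
    ... | yes (j , Pj) = below (toℕ<n j) Pj
    ... | no ∄j        = n , Pn , λ j<n Pj → ∄j (fromℕ< j<n , subst P (sym (toℕ-fromℕ< j<n)) Pj)

  module CyclesOfLength {m} (π : Fin m → Fin m) (π-injective : ∀ {x y} → π x ≡ π y → x ≡ y)
    (d : ℕ) .{{_ : NonZero d}}
    (period : ∀ x → fold x π d ≡ x)
    (aperiodic : ∀ x {j} → 0 < j → j < d → fold x π j ≢ x) where

    fold-injective : ∀ j {x y} → fold x π j ≡ fold y π j → x ≡ y
    fold-injective zero    eq = eq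
    fold-injective (suc j) eq = fold-injective j (π-injective eq)

    fold-period : ∀ q x → fold x π (q * d) ≡ x
    fold-period zero    x = refl
    fold-period (suc q) x = begin
      fold x π (d + q * d)        ≡⟨ fold-+ x π d ⟩
      fold (fold x π (q * d)) π d ≡⟨ cong (λ z → fold z π d) (fold-period q x) ⟩
      fold x π d                  ≡⟨ period x ⟩
      x                           ∎
      where open ≡-Reasoning

    fold-mod : ∀ j x → fold x π (j % d) ≡ fold x π j
    fold-mod j x = begin
      fold x π (j % d)                      ≡⟨ cong (λ z → fold z π (j % d)) (fold-period (j / d) x) ⟨
      fold (fold x π (j / d * d)) π (j % d) ≡⟨ fold-+ x π (j % d) ⟨
      fold x π (j % d + j / d * d)          ≡⟨ cong (fold x π) (m≡m%n+[m/n]*n j d) ⟨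
      fold x π j                            ∎
      where open ≡-Reasoning

    orbit : Fin m → ℕ → Fin m → Bool
    orbit x zero    y = false
    orbit x (suc j) y = does (fold x π j ≟ y) ∨ orbit x j y

    orbit-sound : ∀ x j y → orbit x j y ≡ true → ∃ λ l → l < j × fold x π l ≡ y
    orbit-sound x (suc j) y y∈orbit with fold x π j ≟ y
    ... | yes πʲx≡y = j , ℕ.n<1+n j , πʲx≡y
    ... | no _ with orbit-sound x j y y∈orbit
    ...   | l , l<j , πˡx≡y = l , ℕ.m<n⇒m<1+n l<j , πˡx≡y

    orbit-complete : ∀ x j l → l < j → orbit x j (fold x π l) ≡ true
    orbit-complete x (suc j) l l<1+j with fold x π j ≟ fold x π l | l ℕ.≟ j
    ... | yes _   | _        = refl
    ... | no πʲ≢πˡ | yes refl = contradiction refl πʲ≢πˡ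
    ... | no _    | no l≢j   = orbit-complete x j l (ℕ.≤∧≢⇒< (ℕ.≤-pred l<1+j) l≢j)

    orbit-fresh : ∀ x j → j < d → orbit x j (fold x π j) ≡ false
    orbit-fresh x j j<d with orbit x j (fold x π j) in πʲx∈orbit
    ... | false = refl
    ... | true with orbit-sound x j _ πʲx∈orbit
    ...   | l , l<j , πˡx≡πʲx =
      contradiction returns (aperiodic x (ℕ.m<n⇒0<n∸m l<j) (ℕ.≤-<-trans (ℕ.m∸n≤m j l) j<d))
      where
      returns : fold x π (j ∸ l) ≡ x
      returns = fold-injective l (begin
        fold (fold x π (j ∸ l)) π l ≡⟨ fold-+ x π l ⟨
        fold x π (l + (j ∸ l))      ≡⟨ cong (fold x π) (ℕ.m+[n∸m]≡n (ℕ.<⇒≤ l<j)) ⟩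
        fold x π j                  ≡⟨ πˡx≡πʲx ⟨
        fold x π l                  ∎)
        where open ≡-Reasoning

    count-orbit : ∀ x j → j ≤ d → count (orbit x j) ≡ j
    count-orbit x zero    _     = count-const-false m
    count-orbit x (suc j) 1+j≤d =
      trans (count-insert (fold x π j) (orbit x j) (orbit-fresh x j 1+j≤d))
            (cong suc (count-orbit x j (ℕ.<⇒≤ 1+j≤d)))

    orbit-closed : ∀ x l → orbit x d (fold x π l) ≡ true
    orbit-closed x l =
      subst (λ y → orbit x d y ≡ true) (fold-mod l x) (orbit-complete x d (l % d) (m%n<n l d))

    orbit-invariant : ∀ x y → orbit x d (π y) ≡ orbit x d y
    orbit-invariant x y = bool-ext from-πy to-πy
      where
      from-πy : orbit x d (π y) ≡ true → orbit x d y ≡ true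
      from-πy πy∈orbit with orbit-sound x d (π y) πy∈orbit
      ... | l , _ , πˡx≡πy = subst (λ z → orbit x d z ≡ true) (π-injective πᵏ⁺¹x≡πy) (orbit-closed x k)
        where
        k : ℕ
        k = l + pred d
        1+k≡l+d : suc k ≡ l + d
        1+k≡l+d = trans (sym (ℕ.+-suc l (pred d))) (cong (l +_) (ℕ.suc-pred d))
        πᵏ⁺¹x≡πy : π (fold x π k) ≡ π y
        πᵏ⁺¹x≡πy = begin
          fold x π (suc k)      ≡⟨ cong (fold x π) 1+k≡l+d ⟩
          fold x π (l + d)      ≡⟨ fold-+ x π l ⟩
          fold (fold x π d) π l ≡⟨ cong (λ z → fold z π l) (period x) ⟩
          fold x π l            ≡⟨ πˡx≡πy ⟩
          π y                   ∎
          where open ≡-Reasoning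
      to-πy : orbit x d y ≡ true → orbit x d (π y) ≡ true
      to-πy y∈orbit with orbit-sound x d y y∈orbit
      ... | l , _ , πˡx≡y = subst (λ z → orbit x d z ≡ true) (cong π πˡx≡y) (orbit-closed x (suc l))

    Invariant : (Fin m → Bool) → Set
    Invariant Q = ∀ y → Q (π y) ≡ Q y

    invariant-fold : ∀ {Q} → Invariant Q → ∀ l x → Q (fold x π l) ≡ Q x
    invariant-fold inv zero    x = refl
    invariant-fold inv (suc l) x = trans (inv (fold x π l)) (invariant-fold inv l x)

    count-remove-orbit : ∀ Q → Invariant Q → ∀ x → Q x ≡ true →
      count Q ≡ d + count (λ y → Q y ∧ not (orbit x d y))
    count-remove-orbit Q inv x Qx≡true = begin
      count Q                                         ≡⟨ count-partition Q (orbit x d) ⟩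
      count (λ y → Q y ∧ orbit x d y) + count Q∖orbit ≡⟨ cong (_+ count Q∖orbit) (count-cong orbit⊆Q) ⟩
      count (orbit x d) + count Q∖orbit               ≡⟨ cong (_+ count Q∖orbit) (count-orbit x d ℕ.≤-refl) ⟩
      d + count Q∖orbit                               ∎
      where
      open ≡-Reasoning
      Q∖orbit : Fin m → Bool
      Q∖orbit y = Q y ∧ not (orbit x d y)
      orbit⊆Q : ∀ y → Q y ∧ orbit x d y ≡ orbit x d y
      orbit⊆Q y with orbit x d y in y∈orbit
      ... | false = ∧-zeroʳ (Q y)
      ... | true with orbit-sound x d y y∈orbit
      ...   | l , _ , refl = cong (_∧ true) (trans (invariant-fold inv l x) Qx≡true)

    d∣count-invariant : ∀ Q → Invariant Q → d ∣ count Q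
    d∣count-invariant Q inv = <-rec Claim step (count Q) Q inv refl
      where
      Claim : ℕ → Set
      Claim n = ∀ Q → Invariant Q → count Q ≡ n → d ∣ n
      step : ∀ n → (∀ {k} → k < n → Claim k) → Claim n
      step n smaller Q inv refl with count Q ℕ.≟ 0
      ... | yes count≡0 = subst (d ∣_) (sym count≡0) (d ∣0)
      ... | no count≢0 with count≢0⇒∃ Q count≢0
      ...   | x , Qx≡true = subst (d ∣_) (sym split) (∣m∣n⇒∣m+n ∣-refl d∣count-Q′)
        where
        Q′ : Fin m → Bool
        Q′ y = Q y ∧ not (orbit x d y)
        split : count Q ≡ d + count Q′
        split = count-remove-orbit Q inv x Qx≡true
        d∣count-Q′ : d ∣ count Q′
        d∣count-Q′ = smaller (subst (count Q′ <_) (sym split) (ℕ.m<n+m _ (>-nonZero⁻¹ d))) Q′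
          (λ y → cong₂ (λ a b → a ∧ not b) (inv y) (orbit-invariant x y)) refl

    d∣m : d ∣ m
    d∣m = subst (d ∣_) (count-const-true m) (d∣count-invariant (λ _ → true) (λ _ → refl))

  [1+k]*[1+n]C[1+k]≡[1+n]*nCk : ∀ n k → suc k * (suc n C suc k) ≡ suc n * (n C k)
  [1+k]*[1+n]C[1+k]≡[1+n]*nCk zero    zero    = refl
  [1+k]*[1+n]C[1+k]≡[1+n]*nCk zero    (suc k) = ℕ.*-zeroʳ (suc (suc k))
  [1+k]*[1+n]C[1+k]≡[1+n]*nCk (suc n) zero    =
    trans (ℕ.*-identityˡ _) (trans (nC1≡n (suc (suc n))) (sym (ℕ.*-identityʳ _)))
  [1+k]*[1+n]C[1+k]≡[1+n]*nCk (suc n) (suc k) = begin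
    suc (suc k) * (suc (suc n) C suc (suc k))
      ≡⟨ cong (suc (suc k) *_) (nCk+nC[k+1]≡[n+1]C[k+1] (suc n) (suc k)) ⟨
    suc (suc k) * (a + b)
      ≡⟨ regroup (suc k) a b ⟩
    suc k * a + a + suc (suc k) * b
      ≡⟨ cong₂ (λ u v → u + a + v) ([1+k]*[1+n]C[1+k]≡[1+n]*nCk n k)
                                   ([1+k]*[1+n]C[1+k]≡[1+n]*nCk n (suc k)) ⟩
    suc n * (n C k) + a + suc n * (n C suc k)
      ≡⟨ factor (suc n) (n C k) (n C suc k) a ⟩
    suc n * (n C k + n C suc k) + a
      ≡⟨ cong (λ z → suc n * z + a) (nCk+nC[k+1]≡[n+1]C[k+1] n k) ⟩
    suc n * a + a
      ≡⟨ ℕ.+-comm (suc n * a) a ⟩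
    suc (suc n) * a
      ∎
    where
    open ≡-Reasoning
    a b : ℕ
    a = suc n C suc k
    b = suc n C suc (suc k)
    regroup : ∀ x a b → suc x * (a + b) ≡ x * a + a + suc x * b
    regroup = solve-∀
    factor : ∀ x u v a → x * u + a + x * v ≡ x * (u + v) + a
    factor = solve-∀

  coprime-below-prime-factors : ∀ {s t k} → (∀ p → Prime p → p ∣ s → t ≤ p) → 0 < k → k < t →
                                Coprime s k
  coprime-below-prime-factors {k = suc k} factors≥t _ k<t {d} (d∣s , d∣k)
    with factorise d {{≢-nonZero λ { refl → ℕ.1+n≢0 (0∣⇒≡0 d∣k) }}}
  ... | record { factors = [] ; isFactorisation = d≡1 } = d≡1
  ... | record { factors = p ∷ ps ; isFactorisation = d≡p*ps ; factorsPrime = p-prime ∷ _ } =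
    contradiction (ℕ.≤-trans (factors≥t p p-prime (∣-trans p∣d d∣s)) (∣⇒≤ (∣-trans p∣d d∣k)))
                  (ℕ.<⇒≱ k<t)
    where
    p∣d : p ∣ d
    p∣d = subst (p ∣_) (sym d≡p*ps) (m∣m*n _)

  s∣sCk : ∀ {s t k} → 0 < s → (∀ p → Prime p → p ∣ s → t ≤ p) → 0 < k → k < t → s ∣ s C k
  s∣sCk {suc s} {t} {suc k} _ factors≥t 0<k k<t =
    coprime-divisor (coprime-below-prime-factors factors≥t 0<k k<t)
      (subst (suc s ∣_) (sym ([1+k]*[1+n]C[1+k]≡[1+n]*nCk s k)) (m∣m*n _))

module FiniteGroup {a ℓ} (G : Group a ℓ) where
  open Group G
  open import Algebra.Properties.Group G using (∙-cancelˡ; ∙-cancelʳ)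
  open import Algebra.Properties.Monoid.Mult monoid using (×-homo-+) renaming (_×_ to _times_)
  open import Data.Fin.Properties using (_≟_; pigeonhole)
  open import Data.Nat.Base using (_+_; _*_; _∸_; >-nonZero)
  open import Data.Nat.Divisibility using (divides)
  open import Data.Nat.GeneralisedArithmetic using (fold)
  open import Relation.Nullary.Decidable using (Dec; yes; no; _×-dec_)
  open import Relation.Nullary.Negation using (¬_)
  open import Relation.Binary.Reasoning.Setoid setoid
  open Combinatorics using (least-witness; module CyclesOfLength)

  infixr 8 _^_
  _^_ : Carrier → ℕ → Carrier
  g ^ k = k times g

  ^-multiple : ∀ {g d} → g ^ d ≈ ε → ∀ q → g ^ (q * d) ≈ ε
  ^-multiple         gᵈ≈ε zero    = refl
  ^-multiple {g} {d} gᵈ≈ε (suc q) = begin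
    g ^ (d + q * d)     ≈⟨ ×-homo-+ g d (q * d) ⟩
    g ^ d ∙ g ^ (q * d) ≈⟨ ∙-cong gᵈ≈ε (^-multiple gᵈ≈ε q) ⟩
    ε ∙ ε               ≈⟨ identityˡ ε ⟩
    ε                   ∎

  module _ {m} (card : HasCard Carrier _≈_ m) where
    private
      enum : Fin m → Carrier
      enum = proj₁ card

      enum-injective : ∀ i j → enum i ≈ enum j → i ≡ j
      enum-injective = proj₁ (proj₂ card)

      index : Carrier → Fin m
      index x = proj₁ (proj₂ (proj₂ card) x)

      enum-index : ∀ x → enum (index x) ≈ x
      enum-index x = proj₂ (proj₂ (proj₂ card) x)

      index-injective : ∀ {x y} → index x ≡ index y → x ≈ y
      index-injective {x} {y} eq = begin
        x              ≈⟨ enum-index x ⟨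
        enum (index x) ≡⟨ ≡.cong enum eq ⟩
        enum (index y) ≈⟨ enum-index y ⟩
        y              ∎

      infix 4 _≈?_
      _≈?_ : ∀ x y → Dec (x ≈ y)
      x ≈? y with index x ≟ index y
      ... | yes eq  = yes (index-injective eq)
      ... | no ¬eq = no λ x≈y →
        ¬eq (enum-injective _ _ (trans (enum-index x) (trans x≈y (sym (enum-index y)))))

    module _ (g : Carrier) where
      private
        IsPeriod : ℕ → Set ℓ
        IsPeriod k = 0 < k × g ^ k ≈ ε

        has-period : ∃ IsPeriod
        has-period with pigeonhole (ℕ.n<1+n m) (λ (k : Fin (suc m)) → index (g ^ toℕ k))
        ... | i , j , i<j , eq =
          toℕ j ∸ toℕ i , ℕ.m<n⇒0<n∸m i<j , ∙-cancelʳ (g ^ toℕ i) _ _ (begin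
            g ^ (toℕ j ∸ toℕ i) ∙ g ^ toℕ i ≈⟨ ×-homo-+ g (toℕ j ∸ toℕ i) (toℕ i) ⟨
            g ^ (toℕ j ∸ toℕ i + toℕ i)     ≡⟨ ≡.cong (g ^_) (ℕ.m∸n+n≡m (ℕ.<⇒≤ i<j)) ⟩
            g ^ toℕ j                       ≈⟨ index-injective eq ⟨
            g ^ toℕ i                       ≈⟨ identityˡ _ ⟨
            ε ∙ g ^ toℕ i                   ∎)

        order : ∃ λ d → IsPeriod d × (∀ {j} → j < d → ¬ IsPeriod j)
        order = least-witness (λ k → (0 ℕ.<? k) ×-dec (g ^ k ≈? ε)) (proj₂ has-period)

        π : Fin m → Fin m
        π i = index (g ∙ enum i)

        π-injective : ∀ {i j} → π i ≡ π j → i ≡ j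
        π-injective {i} {j} eq = enum-injective i j (∙-cancelˡ g _ _ (index-injective eq))

        enum-fold : ∀ k i → enum (fold i π k) ≈ g ^ k ∙ enum i
        enum-fold zero    i = sym (identityˡ (enum i))
        enum-fold (suc k) i = begin
          enum (π (fold i π k)) ≈⟨ enum-index _ ⟩
          g ∙ enum (fold i π k) ≈⟨ ∙-congˡ (enum-fold k i) ⟩
          g ∙ (g ^ k ∙ enum i)  ≈⟨ assoc g (g ^ k) (enum i) ⟨
          g ^ suc k ∙ enum i    ∎

      ^-card≈ε : g ^ m ≈ ε
      ^-card≈ε with order
      ... | d , (0<d , gᵈ≈ε) , d-least
          with CyclesOfLength.d∣m π π-injective d {{>-nonZero 0<d}} period aperiodic
        where
        period : ∀ i → fold i π d ≡ i
        period i = enum-injective _ _ (trans (enum-fold d i) (trans (∙-congʳ gᵈ≈ε) (identityˡ _)))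
        aperiodic : ∀ i {j} → 0 < j → j < d → fold i π j ≢ i
        aperiodic i {j} 0<j j<d πʲi≡i = d-least j<d (0<j , ∙-cancelʳ (enum i) _ _ (begin
          g ^ j ∙ enum i    ≈⟨ enum-fold j i ⟨
          enum (fold i π j) ≡⟨ ≡.cong enum πʲi≡i ⟩
          enum i            ≈⟨ identityˡ (enum i) ⟨
          ε ∙ enum i        ∎))
      ... | divides q ≡.refl = ^-multiple gᵈ≈ε q

module _ {a b r s} {A : Set a} {_∼_ : Rel A r} (B : Setoid b s) where
  open Setoid B renaming (Carrier to B′)

  HasCard-map : ∀ {m} (f : A → B′) →
    (∀ x y → x ∼ y → f x ≈ f y) → (∀ x y → f x ≈ f y → x ∼ y) → (∀ y → ∃ λ x → f x ≈ y) →
    HasCard A _∼_ m → HasCard B′ _≈_ m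
  HasCard-map f f-cong f-injective f-surjective (enum , enum-injective , enum-surjective) =
    f ∘ enum ,
    (λ i j fᵢ≈fⱼ → enum-injective i j (f-injective _ _ fᵢ≈fⱼ)) ,
    λ y → let (x , fx≈y) = f-surjective y
              (i , eᵢ∼x) = enum-surjective x
          in i , trans (f-cong _ _ eᵢ∼x) fx≈y

funToFin-cong : ∀ {k b} {f g : Fin k → Fin b} → (∀ i → f i ≡ g i) → funToFin f ≡ funToFin g
funToFin-cong {zero}  f≗g = ≡.refl
funToFin-cong {suc k} f≗g = ≡.cong₂ combine (f≗g zero) (funToFin-cong (f≗g ∘ suc))

HasCard-Π : ∀ {a r} {A : Set a} (_∼_ : Rel A r) {b} k → HasCard A _∼_ b →
            HasCard (Fin k → A) (Pointwise _∼_) (b ℕ.^ k)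
HasCard-Π {A = A} _∼_ {b} k (enum , enum-injective , enum-surjective) =
  enumΠ , enumΠ-injective , enumΠ-surjective
  where
  enumΠ : Fin (b ℕ.^ k) → Fin k → A
  enumΠ t i = enum (finToFun t i)

  enumΠ-injective : ∀ t t′ → Pointwise _∼_ (enumΠ t) (enumΠ t′) → t ≡ t′
  enumΠ-injective t t′ eq = begin
    t                              ≡⟨ funToFin-finToFin {k} {b} t ⟨
    funToFin (finToFun {b} {k} t)  ≡⟨ funToFin-cong (λ i → enum-injective _ _ (eq i)) ⟩
    funToFin (finToFun {b} {k} t′) ≡⟨ funToFin-finToFin {k} {b} t′ ⟩
    t′                             ∎
    where open ≡.≡-Reasoning

  enumΠ-surjective : ∀ u → ∃ λ t → Pointwise _∼_ (enumΠ t) u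
  enumΠ-surjective u = funToFin index , λ i →
    ≡.subst (λ j → enum j ∼ u i) (≡.sym (finToFun-funToFin index i)) (proj₂ (enum-surjective (u i)))
    where
    index : Fin k → Fin b
    index i = proj₁ (enum-surjective (u i))

module _ {c ℓ} (S : Ring c ℓ) where
  open Ring S
  open import Algebra.Properties.Monoid *-monoid using (cancelᶜ; introˡ; elimʳ)
  open import Relation.Binary.Reasoning.Setoid setoid

  IsInvertible : Carrier → Set (c ⊔ ℓ)
  IsInvertible x = Σ Carrier λ y → x * y ≈ 1# × y * x ≈ 1#

  private
    Units : Set (c ⊔ ℓ)
    Units = Σ Carrier IsInvertible

    _·_ : Units → Units → Units
    (x , x⁻¹ , xx⁻¹≈1 , x⁻¹x≈1) · (y , y⁻¹ , yy⁻¹≈1 , y⁻¹y≈1) =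
      x * y , y⁻¹ * x⁻¹ ,
      trans (cancelᶜ yy⁻¹≈1 x x⁻¹) xx⁻¹≈1 , trans (cancelᶜ x⁻¹x≈1 y⁻¹ y) y⁻¹y≈1

    inverse : Units → Units
    inverse (x , x⁻¹ , xx⁻¹≈1 , x⁻¹x≈1) = x⁻¹ , x , x⁻¹x≈1 , xx⁻¹≈1

    inverse-unique : ∀ {x x′ y y′} → x ≈ y → x * x′ ≈ 1# → y′ * y ≈ 1# → x′ ≈ y′
    inverse-unique {x} {x′} {y} {y′} x≈y xx′≈1 y′y≈1 = begin
      x′            ≈⟨ introˡ y′y≈1 x′ ⟩
      y′ * y * x′   ≈⟨ *-assoc y′ y x′ ⟩
      y′ * (y * x′) ≈⟨ *-congˡ (*-congʳ x≈y) ⟨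
      y′ * (x * x′) ≈⟨ elimʳ xx′≈1 y′ ⟩
      y′            ∎

  unitGroup : Group (c ⊔ ℓ) ℓ
  unitGroup = record
    { Carrier = Units
    ; _≈_     = λ u v → proj₁ u ≈ proj₁ v
    ; _∙_     = _·_
    ; ε       = 1# , 1# , *-identityˡ 1# , *-identityˡ 1#
    ; _⁻¹     = inverse
    ; isGroup = record
      { isMonoid = record
        { isSemigroup = record
          { isMagma = record
            { isEquivalence = record { refl = refl ; sym = sym ; trans = trans }
            ; ∙-cong        = *-cong
            }
          ; assoc = λ u v w → *-assoc (proj₁ u) (proj₁ v) (proj₁ w)
          }
        ; identity = (λ u → *-identityˡ (proj₁ u)) , (λ u → *-identityʳ (proj₁ u))
        }
      ; inverse = (λ u → proj₂ (proj₂ (proj₂ u))) , (λ u → proj₁ (proj₂ (proj₂ u)))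
      ; ⁻¹-cong = λ {u} {v} u≈v → inverse-unique u≈v (proj₁ (proj₂ (proj₂ u))) (proj₂ (proj₂ (proj₂ v)))
      }
    }

module _ {a ℓ p} (G : Group a ℓ) (P : Group.Carrier G → Set p) where
  open Group G

  subgroup : P ε → (∀ x y → P x → P y → P (x ∙ y)) → (∀ x → P x → P (x ⁻¹)) → Group (a ⊔ p) ℓ
  subgroup Pε P∙ P⁻¹ = record
    { Carrier = Σ Carrier P
    ; _≈_     = λ u v → proj₁ u ≈ proj₁ v
    ; _∙_     = λ u v → proj₁ u ∙ proj₁ v , P∙ _ _ (proj₂ u) (proj₂ v)
    ; ε       = ε , Pε
    ; _⁻¹     = λ u → proj₁ u ⁻¹ , P⁻¹ _ (proj₂ u)
    ; isGroup = record
      { isMonoid = record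
        { isSemigroup = record
          { isMagma = record
            { isEquivalence = record { refl = refl ; sym = sym ; trans = trans }
            ; ∙-cong        = ∙-cong
            }
          ; assoc = λ u v w → assoc (proj₁ u) (proj₁ v) (proj₁ w)
          }
        ; identity = (λ u → identityˡ (proj₁ u)) , (λ u → identityʳ (proj₁ u))
        }
      ; inverse = (λ u → inverseˡ (proj₁ u)) , (λ u → inverseʳ (proj₁ u))
      ; ⁻¹-cong = ⁻¹-cong
      }
    }

record IsIdeal {c ℓ p} (S : Ring c ℓ) (P : Ring.Carrier S → Set p) : Set (c ⊔ ℓ ⊔ p) where
  open Ring S
  field
    ∈-resp-≈ : ∀ {x y} → x ≈ y → P x → P y
    0∈       : P 0#
    +∈       : ∀ {x y} → P x → P y → P (x + y)
    -∈       : ∀ {x} → P x → P (- x)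
    *ˡ∈      : ∀ r {x} → P x → P (r * x)
    *ʳ∈      : ∀ r {x} → P x → P (x * r)

module _ {c ℓ p} {S : Ring c ℓ} {P : Ring.Carrier S → Set p} (I : IsIdeal S P) where
  open Ring S hiding (zero)
  open IsIdeal I
  open import Algebra.Properties.Semiring.Sum semiring using (sum)
  open import Algebra.Properties.Semiring.Mult semiring using () renaming (_×_ to _times_)

  times-∈ : ∀ k {x} → P x → P (k times x)
  times-∈ zero    x∈I = 0∈
  times-∈ (suc k) x∈I = +∈ x∈I (times-∈ k x∈I)

  sum-∈ : ∀ {m} (f : Fin m → Carrier) → (∀ i → P (f i)) → P (sum f)
  sum-∈ {zero}  f f∈I = 0∈
  sum-∈ {suc m} f f∈I = +∈ (f∈I zero) (sum-∈ (f ∘ suc) (f∈I ∘ suc))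

module _ {c ℓ p} (S : Ring c ℓ) {P : Ring.Carrier S → Set p} (I : IsIdeal S P) where
  open Ring S
  open IsIdeal I
  open import Algebra.Properties.Ring S using ([y-z]x≈yx-zx; x[y-z]≈xy-xz)
  open import Algebra.Properties.Group +-group using (x≈y⇒x∙y⁻¹≈ε)
  open import Algebra.Properties.AbelianGroup +-abelianGroup using (⁻¹-anti-homo‿-; ⁻¹-∙-comm)
  open import Algebra.Properties.Monoid +-monoid using (cancelᶜ)
  open import Algebra.Properties.CommutativeSemigroup +-commutativeSemigroup using (interchange)

  infix 4 _≈ᴵ_
  _≈ᴵ_ : Rel Carrier p
  x ≈ᴵ y = P (x - y)

  ≈⇒≈ᴵ : ∀ {x y} → x ≈ y → x ≈ᴵ y
  ≈⇒≈ᴵ x≈y = ∈-resp-≈ (sym (x≈y⇒x∙y⁻¹≈ε x≈y)) 0∈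

  private
    ≈ᴵ-trans : ∀ {x y z} → x ≈ᴵ y → y ≈ᴵ z → x ≈ᴵ z
    ≈ᴵ-trans {x} {y} {z} x≈y y≈z = ∈-resp-≈ (cancelᶜ (-‿inverseˡ y) x (- z)) (+∈ x≈y y≈z)

    +-congᴵ : ∀ {x y u v} → x ≈ᴵ y → u ≈ᴵ v → x + u ≈ᴵ y + v
    +-congᴵ {x} {y} {u} {v} x≈y u≈v =
      ∈-resp-≈ (trans (interchange x (- y) u (- v)) (+-congˡ (⁻¹-∙-comm y v))) (+∈ x≈y u≈v)

    *-congᴵ : ∀ {x y u v} → x ≈ᴵ y → u ≈ᴵ v → x * u ≈ᴵ y * v
    *-congᴵ {x} {y} {u} {v} x≈y u≈v = ∈-resp-≈ telescope (+∈ (*ʳ∈ u x≈y) (*ˡ∈ y u≈v))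
      where
      telescope : (x - y) * u + y * (u - v) ≈ x * u - y * v
      telescope = trans (+-cong ([y-z]x≈yx-zx u x y) (x[y-z]≈xy-xz y u v))
                        (cancelᶜ (-‿inverseˡ (y * u)) (x * u) (- (y * v)))

  _/_ : Ring c p
  _/_ = record
    { Carrier = Carrier
    ; _≈_     = _≈ᴵ_
    ; _+_     = _+_
    ; _*_     = _*_
    ; -_      = -_
    ; 0#      = 0#
    ; 1#      = 1#
    ; isRing  = record
      { +-isAbelianGroup = record
        { isGroup = record
          { isMonoid = record
            { isSemigroup = record
              { isMagma = record
                { isEquivalence = record
                  { refl  = ≈⇒≈ᴵ refl
                  ; sym   = λ {x} {y} x≈y → ∈-resp-≈ (⁻¹-anti-homo‿- x y) (-∈ x≈y)
                  ; trans = ≈ᴵ-trans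
                  }
                ; ∙-cong = +-congᴵ
                }
              ; assoc = λ x y z → ≈⇒≈ᴵ (+-assoc x y z)
              }
            ; identity = (λ x → ≈⇒≈ᴵ (+-identityˡ x)) , (λ x → ≈⇒≈ᴵ (+-identityʳ x))
            }
          ; inverse = (λ x → ≈⇒≈ᴵ (-‿inverseˡ x)) , (λ x → ≈⇒≈ᴵ (-‿inverseʳ x))
          ; ⁻¹-cong = λ {x} {y} x≈y → ∈-resp-≈ (sym (⁻¹-∙-comm x (- y))) (-∈ x≈y)
          }
        ; comm = λ x y → ≈⇒≈ᴵ (+-comm x y)
        }
      ; *-cong     = *-congᴵ
      ; *-assoc    = λ x y z → ≈⇒≈ᴵ (*-assoc x y z)
      ; *-identity = (λ x → ≈⇒≈ᴵ (*-identityˡ x)) , (λ x → ≈⇒≈ᴵ (*-identityʳ x))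
      ; distrib    = (λ x y z → ≈⇒≈ᴵ (distribˡ x y z)) , (λ x y z → ≈⇒≈ᴵ (distribʳ x y z))
      }
    }

  invertible-/ : ∀ {x} → IsInvertible S x → IsInvertible _/_ x
  invertible-/ (y , xy≈1 , yx≈1) = y , ≈⇒≈ᴵ xy≈1 , ≈⇒≈ᴵ yx≈1

module Matrices {c ℓ} (R : CommutativeRing c ℓ) where
  open CommutativeRing R hiding (zero)
  open RingDefs R
  open import Algebra.Properties.Semiring.Sum semiring using
    (sum; sum-cong-≋; sum-replicate-zero; sum-remove; ∑-distrib-+; ∑-comm; *-distribˡ-sum; *-distribʳ-sum)
  open import Data.Fin.Base using (punchIn)
  open import Data.Fin.Properties using (_≟_; punchInᵢ≢i)
  open import Relation.Nullary.Decidable using (yes; no)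
  open import Relation.Nullary.Negation using (contradiction)
  open import Relation.Binary.Reasoning.Setoid setoid

  ∑≡sum : ∀ {n} (f : Fin n → Carrier) → ∑ f ≡ sum f
  ∑≡sum {zero}  f = ≡.refl
  ∑≡sum {suc n} f = ≡.cong (f zero +_) (∑≡sum (f ∘ suc))

  ∑-cong : ∀ {n} {f g : Fin n → Carrier} → (∀ i → f i ≈ g i) → ∑ f ≈ ∑ g
  ∑-cong {f = f} {g} f≈g = begin
    ∑ f   ≡⟨ ∑≡sum f ⟩
    sum f ≈⟨ sum-cong-≋ f≈g ⟩
    sum g ≡⟨ ∑≡sum g ⟨
    ∑ g   ∎

  ∑-distrib : ∀ {n} (f g : Fin n → Carrier) → ∑ (λ i → f i + g i) ≈ ∑ f + ∑ g
  ∑-distrib f g = begin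
    ∑ (λ i → f i + g i)   ≡⟨ ∑≡sum (λ i → f i + g i) ⟩
    sum (λ i → f i + g i) ≈⟨ ∑-distrib-+ f g ⟩
    sum f + sum g         ≡⟨ ≡.cong₂ _+_ (∑≡sum f) (∑≡sum g) ⟨
    ∑ f + ∑ g             ∎

  ∑-zero : ∀ {n} {f : Fin n → Carrier} → (∀ i → f i ≈ 0#) → ∑ f ≈ 0#
  ∑-zero {n} f≈0 = trans (∑-cong f≈0) (trans (reflexive (∑≡sum {n} (λ _ → 0#))) (sum-replicate-zero n))

  ∑-select : ∀ {n} (f : Fin n → Carrier) i → (∀ j → j ≢ i → f j ≈ 0#) → ∑ f ≈ f i
  ∑-select {suc n} f i f≈0 = begin
    ∑ f                       ≡⟨ ∑≡sum f ⟩
    sum f                     ≈⟨ sum-remove f ⟩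
    f i + sum (f ∘ punchIn i) ≡⟨ ≡.cong (f i +_) (∑≡sum (f ∘ punchIn i)) ⟨
    f i + ∑ (f ∘ punchIn i)   ≈⟨ +-congˡ (∑-zero (λ j → f≈0 (punchIn i j) (punchInᵢ≢i i j))) ⟩
    f i + 0#                  ≈⟨ +-identityʳ (f i) ⟩
    f i                       ∎

  𝟙-diagonal : ∀ {n} (i : Fin n) → 𝟙 i i ≈ 1#
  𝟙-diagonal i with i ≟ i
  ... | yes _  = refl
  ... | no i≢i = contradiction ≡.refl i≢i

  𝟙-off-diagonal : ∀ {n} {i j : Fin n} → i ≢ j → 𝟙 i j ≈ 0#
  𝟙-off-diagonal {i = i} {j} i≢j with i ≟ j
  ... | yes i≡j = contradiction i≡j i≢j
  ... | no _    = refl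

  module _ {n : ℕ} where
    infixl 6 _+ᴹ_
    _+ᴹ_ : Mat n → Mat n → Mat n
    (A +ᴹ B) i j = A i j + B i j

    -ᴹ_ : Mat n → Mat n
    (-ᴹ A) i j = - A i j

    0ᴹ : Mat n
    0ᴹ i j = 0#

    ⊗-cong : ∀ {A A′ B B′ : Mat n} → A ≈ᴹ A′ → B ≈ᴹ B′ → (A ⊗ B) ≈ᴹ (A′ ⊗ B′)
    ⊗-cong A≈A′ B≈B′ i j = ∑-cong λ k → *-cong (A≈A′ i k) (B≈B′ k j)

    ⊗-assoc : ∀ (A B C : Mat n) → ((A ⊗ B) ⊗ C) ≈ᴹ (A ⊗ (B ⊗ C))
    ⊗-assoc A B C i j = begin
      ((A ⊗ B) ⊗ C) i j
        ≡⟨ ∑≡sum (λ k → (A ⊗ B) i k * C k j) ⟩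
      sum (λ k → (A ⊗ B) i k * C k j)
        ≈⟨ sum-cong-≋ (λ k → *-congʳ (reflexive (∑≡sum (λ l → A i l * B l k)))) ⟩
      sum (λ k → sum (λ l → A i l * B l k) * C k j)
        ≈⟨ sum-cong-≋ (λ k → *-distribʳ-sum (C k j) (λ l → A i l * B l k)) ⟩
      sum (λ k → sum (λ l → A i l * B l k * C k j))
        ≈⟨ ∑-comm (λ k l → A i l * B l k * C k j) ⟩
      sum (λ l → sum (λ k → A i l * B l k * C k j))
        ≈⟨ sum-cong-≋ (λ l → sum-cong-≋ λ k → *-assoc (A i l) (B l k) (C k j)) ⟩
      sum (λ l → sum (λ k → A i l * (B l k * C k j)))
        ≈⟨ sum-cong-≋ (λ l → *-distribˡ-sum (A i l) (λ k → B l k * C k j)) ⟨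
      sum (λ l → A i l * sum (λ k → B l k * C k j))
        ≈⟨ sum-cong-≋ (λ l → *-congˡ (reflexive (∑≡sum (λ k → B l k * C k j)))) ⟨
      sum (λ l → A i l * (B ⊗ C) l j)
        ≡⟨ ∑≡sum (λ l → A i l * (B ⊗ C) l j) ⟨
      (A ⊗ (B ⊗ C)) i j
        ∎

    ⊗-identityˡ : ∀ (A : Mat n) → (𝟙 ⊗ A) ≈ᴹ A
    ⊗-identityˡ A i j = begin
      (𝟙 ⊗ A) i j   ≈⟨ ∑-select (λ k → 𝟙 i k * A k j) i off-diagonal≈0 ⟩
      𝟙 i i * A i j ≈⟨ *-congʳ (𝟙-diagonal i) ⟩
      1# * A i j    ≈⟨ *-identityˡ (A i j) ⟩
      A i j         ∎
      where
      off-diagonal≈0 : ∀ k → k ≢ i → 𝟙 i k * A k j ≈ 0#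
      off-diagonal≈0 k k≢i = trans (*-congʳ (𝟙-off-diagonal (k≢i ∘ ≡.sym))) (zeroˡ (A k j))

    ⊗-identityʳ : ∀ (A : Mat n) → (A ⊗ 𝟙) ≈ᴹ A
    ⊗-identityʳ A i j = begin
      (A ⊗ 𝟙) i j   ≈⟨ ∑-select (λ k → A i k * 𝟙 k j) j off-diagonal≈0 ⟩
      A i j * 𝟙 j j ≈⟨ *-congˡ (𝟙-diagonal j) ⟩
      A i j * 1#    ≈⟨ *-identityʳ (A i j) ⟩
      A i j         ∎
      where
      off-diagonal≈0 : ∀ k → k ≢ j → A i k * 𝟙 k j ≈ 0#
      off-diagonal≈0 k k≢j = trans (*-congˡ (𝟙-off-diagonal k≢j)) (zeroʳ (A i k))

    ⊗-distribˡ : ∀ (A B C : Mat n) → (A ⊗ (B +ᴹ C)) ≈ᴹ ((A ⊗ B) +ᴹ (A ⊗ C))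
    ⊗-distribˡ A B C i j = begin
      (A ⊗ (B +ᴹ C)) i j                      ≈⟨ ∑-cong (λ k → distribˡ (A i k) (B k j) (C k j)) ⟩
      ∑ (λ k → A i k * B k j + A i k * C k j) ≈⟨ ∑-distrib (λ k → A i k * B k j) (λ k → A i k * C k j) ⟩
      (A ⊗ B) i j + (A ⊗ C) i j               ∎

    ⊗-distribʳ : ∀ (A B C : Mat n) → ((B +ᴹ C) ⊗ A) ≈ᴹ ((B ⊗ A) +ᴹ (C ⊗ A))
    ⊗-distribʳ A B C i j = begin
      ((B +ᴹ C) ⊗ A) i j                      ≈⟨ ∑-cong (λ k → distribʳ (A k j) (B i k) (C i k)) ⟩
      ∑ (λ k → B i k * A k j + C i k * A k j) ≈⟨ ∑-distrib (λ k → B i k * A k j) (λ k → C i k * A k j) ⟩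
      (B ⊗ A) i j + (C ⊗ A) i j               ∎

  matRing : ℕ → Ring c ℓ
  matRing n = record
    { Carrier = Mat n
    ; _≈_     = _≈ᴹ_
    ; _+_     = _+ᴹ_
    ; _*_     = _⊗_
    ; -_      = -ᴹ_
    ; 0#      = 0ᴹ
    ; 1#      = 𝟙
    ; isRing  = record
      { +-isAbelianGroup = record
        { isGroup = record
          { isMonoid = record
            { isSemigroup = record
              { isMagma = record
                { isEquivalence = record
                  { refl  = λ i j → refl
                  ; sym   = λ A≈B i j → sym (A≈B i j)
                  ; trans = λ A≈B B≈C i j → trans (A≈B i j) (B≈C i j)
                  }
                ; ∙-cong = λ A≈A′ B≈B′ i j → +-cong (A≈A′ i j) (B≈B′ i j)
                }
              ; assoc = λ A B C i j → +-assoc (A i j) (B i j) (C i j)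
              }
            ; identity = (λ A i j → +-identityˡ (A i j)) , (λ A i j → +-identityʳ (A i j))
            }
          ; inverse = (λ A i j → -‿inverseˡ (A i j)) , (λ A i j → -‿inverseʳ (A i j))
          ; ⁻¹-cong = λ A≈B i j → -‿cong (A≈B i j)
          }
        ; comm = λ A B i j → +-comm (A i j) (B i j)
        }
      ; *-cong     = ⊗-cong
      ; *-assoc    = ⊗-assoc
      ; *-identity = ⊗-identityˡ , ⊗-identityʳ
      ; distrib    = ⊗-distribˡ , ⊗-distribʳ
      }
    }

  module _ {p} (I : Ideal p) where
    ∑-∈ : ∀ {n} (f : Fin n → Carrier) → (∀ k → mem I (f k)) → mem I (∑ f)
    ∑-∈ {zero}  f f∈I = 0∈ I
    ∑-∈ {suc n} f f∈I = +∈ I (f∈I zero) (∑-∈ (f ∘ suc) (f∈I ∘ suc))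

    InMat : ∀ {n} → Mat n → Set p
    InMat A = ∀ i j → mem I (A i j)

    -- matRing n / matIdeal I is Mₙ(R/I); its equality is _≡ᴹ[ I ]_ and its unit type is
    -- UnitsMod n I, both definitionally.
    matIdeal : ∀ {n} → IsIdeal (matRing n) InMat
    matIdeal = record
      { ∈-resp-≈ = λ A≈B A∈I i j → resp I (A≈B i j) (A∈I i j)
      ; 0∈       = λ i j → 0∈ I
      ; +∈       = λ A∈I B∈I i j → +∈ I (A∈I i j) (B∈I i j)
      ; -∈       = λ A∈I i j → -∈ I (A∈I i j)
      ; *ˡ∈      = λ C A∈I i j → ∑-∈ _ λ k → *∈ I (C i k) (A∈I k j)
      ; *ʳ∈      = λ C A∈I i j → ∑-∈ _ λ k → resp I (*-comm (C k j) _) (*∈ I (C k j) (A∈I i k))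
      }

module _ {c ℓ} (R : CommutativeRing c ℓ) where
  open CommutativeRing R hiding (zero)
  open RingDefs R
  open Matrices R
  open import Algebra.Properties.CommutativeSemigroup *-commutativeSemigroup using (x∙yz≈y∙xz)
  open import Data.Nat.Combinatorics using (_C_)
  open import Data.Nat.Divisibility using (divides)
  open import Data.Vec.Base using ([]; _∷_)
  open import Data.Vec.Relation.Unary.All using ([]; _∷_)
  open import Relation.Nullary.Decidable using (Dec; yes; no)
  open Combinatorics using (s∣sCk)

  module _ {p} (I : Ideal p) where
    InPow-0 : ∀ x → InPow I 0 x
    InPow-0 x = rsp (*-identityʳ x) (mul x (prod [] []))

    InPow-* : ∀ {t x y} → mem I x → InPow I t y → InPow I (suc t) (x * y)
    InPow-*         x∈I (prod ys ys∈I) = prod (_ ∷ ys) (x∈I ∷ ys∈I)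
    InPow-* {x = x} x∈I zer            = rsp (sym (zeroʳ x)) zer
    InPow-* {x = x} x∈I (add u v)      = rsp (sym (distribˡ x _ _)) (add (InPow-* x∈I u) (InPow-* x∈I v))
    InPow-* {x = x} x∈I (mul r {y} u)  = rsp (x∙yz≈y∙xz r x y) (mul r (InPow-* x∈I u))
    InPow-*         x∈I (rsp y≈y′ u)   = rsp (*-congˡ y≈y′) (InPow-* x∈I u)

    InPow-∑ : ∀ {t n} (f : Fin n → Carrier) → (∀ k → InPow I t (f k)) → InPow I t (∑ f)
    InPow-∑ {n = zero}  f f∈Iᵗ = zer
    InPow-∑ {n = suc n} f f∈Iᵗ = add (f∈Iᵗ zero) (InPow-∑ (f ∘ suc) (f∈Iᵗ ∘ suc))

  module _ {n : ℕ} where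
    private
      module M = Ring (matRing n)
    open import Algebra.Properties.Semiring.Exp M.semiring using (_^_; ^-congˡ; ^-assocʳ; ^-homo-*)
    open import Algebra.Properties.Semiring.Mult M.semiring using (×-assocˡ) renaming (_×_ to _times_)
    import Algebra.Properties.Semiring.Binomial M.semiring as Binomial

    ^ᴹ≡^ : ∀ (A : Mat n) k → A ^ᴹ k ≡ A ^ k
    ^ᴹ≡^ A zero    = ≡.refl
    ^ᴹ≡^ A (suc k) = ≡.cong (A ⊗_) (^ᴹ≡^ A k)

    ^ᴹ-*-assoc : ∀ (A : Mat n) a b → ((A ^ᴹ a) ^ᴹ b) ≈ᴹ (A ^ᴹ (a ℕ.* b))
    ^ᴹ-*-assoc A a b rewrite ^ᴹ≡^ (A ^ᴹ a) b | ^ᴹ≡^ A a | ^ᴹ≡^ A (a ℕ.* b) = ^-assocʳ A a b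

    ^ᴹ-comm : ∀ (A : Mat n) m → ((A ^ᴹ m) ⊗ A) ≈ᴹ (A ^ᴹ suc m)
    ^ᴹ-comm A m rewrite ^ᴹ≡^ A m = begin
      (A ^ m) ⊗ A       ≈⟨ M.*-congˡ (M.*-identityʳ A) ⟨
      (A ^ m) ⊗ (A ^ 1) ≈⟨ ^-homo-* A m 1 ⟨
      A ^ (m ℕ.+ 1)     ≡⟨ ≡.cong (A ^_) (ℕ.+-comm m 1) ⟩
      A ^ suc m         ∎
      where open import Relation.Binary.Reasoning.Setoid M.setoid

    times-entry : ∀ k (A : Mat n) i j → (k times A) i j ≡ k · A i j
    times-entry zero    A i j = ≡.refl
    times-entry (suc k) A i j = ≡.cong (A i j +_) (times-entry k A i j)

    ^-InPow : ∀ {p} {I : Ideal p} {Y : Mat n} → InMat I Y → ∀ k i j → InPow I k ((Y ^ k) i j)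
    ^-InPow {I = I} Y∈I zero    i j = InPow-0 I (𝟙 i j)
    ^-InPow {I = I} {Y} Y∈I (suc k) i j =
      InPow-∑ I (λ l → Y i l * (Y ^ k) l j) (λ l → InPow-* I (Y∈I i l) (^-InPow Y∈I k l j))

    ^-∈ : ∀ {p q} {I : Ideal p} {J : Ideal q} {t} → (∀ x → InPow I t x → mem J x) →
          ∀ {Y : Mat n} → InMat I Y → ∀ {l} → t ≤ l → InMat J (Y ^ l)
    ^-∈ {J = J} {t} Iᵗ⊆J {Y} Y∈I {l} t≤l = ≡.subst (λ m → InMat J (Y ^ m)) (ℕ.m+[n∸m]≡n t≤l)
      (Mₙ[J].∈-resp-≈ (M.sym (^-homo-* Y t (l ℕ.∸ t))) (Mₙ[J].*ʳ∈ (Y ^ (l ℕ.∸ t)) Yᵗ∈J))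
      where
      module Mₙ[J] = IsIdeal (matIdeal J)
      Yᵗ∈J : InMat J (Y ^ t)
      Yᵗ∈J i j = Iᵗ⊆J _ (^-InPow Y∈I t i j)

    binomial-tail-∈ : ∀ {p q} {I : Ideal p} {J : Ideal q} {t s} →
      (∀ x → InPow I t x → mem J x) → CharCond I J t s →
      ∀ {Y : Mat n} → InMat I Y → ∀ k → InMat J (Binomial.binomialTerm Y 𝟙 s (suc k))
    binomial-tail-∈ {I = I} {J} {t} {s} Iᵗ⊆J (0<s , sI⊆J , factors≥t) {Y} Y∈I k = term∈J (l ℕ.<? t)
      where
      module Mₙ[I] = IsIdeal (matIdeal I)
      module Mₙ[J] = IsIdeal (matIdeal J)

      l : ℕ
      l = suc (toℕ k)

      W : Mat n
      W = (Y ^ l) ⊗ (𝟙 ^ (s ℕ.∸ l))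

      term∈J : Dec (l < t) → InMat J ((s C l) times W)
      term∈J (yes l<t) with s∣sCk 0<s factors≥t (s≤s z≤n) l<t
      ... | divides q sCl≡q*s = ≡.subst (λ m → InMat J (m times W)) (≡.sym sCl≡q*s)
              (Mₙ[J].∈-resp-≈ (×-assocˡ W q s) (times-∈ (matIdeal J) q sW∈J))
        where
        W∈I : InMat I W
        W∈I = Mₙ[I].*ʳ∈ (𝟙 ^ (s ℕ.∸ l)) (Mₙ[I].*ʳ∈ (Y ^ toℕ k) Y∈I)
        sW∈J : InMat J (s times W)
        sW∈J i j = ≡.subst (mem J) (≡.sym (times-entry s W i j)) (sI⊆J _ (W∈I i j))
      term∈J (no l≮t) =
        times-∈ (matIdeal J) (s C l) (Mₙ[J].*ʳ∈ (𝟙 ^ (s ℕ.∸ l)) (^-∈ {J = J} Iᵗ⊆J Y∈I (ℕ.≮⇒≥ l≮t)))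

    ^-char≡𝟙 : ∀ {p q} {I : Ideal p} {J : Ideal q} {t s} →
      (∀ x → InPow I t x → mem J x) → CharCond I J t s →
      ∀ {X : Mat n} → X ≡ᴹ[ I ] 𝟙 → (X ^ᴹ s) ≡ᴹ[ J ] 𝟙
    ^-char≡𝟙 {J = J} {s = s} Iᵗ⊆J char {X} X≡𝟙 =
      IsIdeal.∈-resp-≈ (matIdeal J) (M.sym X^s-𝟙≈tail)
        (sum-∈ (matIdeal J) _ (binomial-tail-∈ {J = J} Iᵗ⊆J char {X M.- 𝟙} X≡𝟙))
      where
      open Binomial (X M.- 𝟙) 𝟙 using (binomialTerm; theorem)
      open import Algebra.Properties.Semiring.Sum M.semiring using (sum)
      open import Algebra.Properties.Monoid M.+-monoid using (cancelʳ)
      open import Algebra.Properties.AbelianGroup M.+-abelianGroup using (xyx⁻¹≈y)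
      open import Relation.Binary.Reasoning.Setoid M.setoid

      Y : Mat n
      Y = X M.- 𝟙

      tail : Mat n
      tail = sum (λ k → binomialTerm s (suc k))

      𝟙^k≈𝟙 : ∀ k → (𝟙 ^ k) ≈ᴹ 𝟙
      𝟙^k≈𝟙 zero    = M.refl
      𝟙^k≈𝟙 (suc k) = M.trans (M.*-identityˡ (𝟙 ^ k)) (𝟙^k≈𝟙 k)

      Y𝟙≈𝟙Y : (Y ⊗ 𝟙) ≈ᴹ (𝟙 ⊗ Y)
      Y𝟙≈𝟙Y = M.trans (M.*-identityʳ Y) (M.sym (M.*-identityˡ Y))

      first-term≈𝟙 : binomialTerm s zero ≈ᴹ 𝟙
      first-term≈𝟙 = M.trans (M.+-identityʳ _) (M.trans (M.*-identityˡ (𝟙 ^ s)) (𝟙^k≈𝟙 s))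

      X^s-𝟙≈tail : ((X ^ᴹ s) M.- 𝟙) ≈ᴹ tail
      X^s-𝟙≈tail = begin
        X ^ᴹ s M.- 𝟙                       ≡⟨ ≡.cong (M._- 𝟙) (^ᴹ≡^ X s) ⟩
        X ^ s M.- 𝟙                        ≈⟨ M.+-congʳ (^-congˡ s (cancelʳ (M.-‿inverseˡ 𝟙) X)) ⟨
        (Y M.+ 𝟙) ^ s M.- 𝟙                ≈⟨ M.+-congʳ (theorem Y𝟙≈𝟙Y s) ⟩
        binomialTerm s zero M.+ tail M.- 𝟙 ≈⟨ M.+-congʳ (M.+-congʳ first-term≈𝟙) ⟩
        𝟙 M.+ tail M.- 𝟙                   ≈⟨ xyx⁻¹≈y 𝟙 tail ⟩
        tail                               ∎

  module _ {n : ℕ} {p} (J : Ideal p) where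
    GL : Group (c ⊔ p) p
    GL = unitGroup (matRing n / matIdeal J)

    GL-^ : ∀ (g : UnitsMod n J) k → proj₁ (FiniteGroup._^_ GL g k) ≡ proj₁ g ^ᴹ k
    GL-^ g zero    = ≡.refl
    GL-^ g (suc k) = ≡.cong (proj₁ g ⊗_) (GL-^ g k)

    ^ᴹ-suc≡𝟙⇒unit : ∀ {X : Mat n} m → (X ^ᴹ suc m) ≡ᴹ[ J ] 𝟙 → IsUnitMod J X
    ^ᴹ-suc≡𝟙⇒unit {X} m X^[1+m]≡𝟙 =
      X ^ᴹ m , X^[1+m]≡𝟙 ,
      Ring.trans (matRing n / matIdeal J) (≈⇒≈ᴵ (matRing n) (matIdeal J) (^ᴹ-comm X m)) X^[1+m]≡𝟙

  module CNC {p} (n k : ℕ) (N : ℕ → Ideal p) (t s : ℕ → ℕ) (1≤k : 1 ≤ k)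
    (Nₖ≈0 : ∀ x → mem (N k) x → IsZero x)
    (nilpotency : ∀ i → 1 ≤ i → i < k → IsNilIndex (N i) (N (suc i)) (t i))
    (characteristic : ∀ i → 1 ≤ i → i < k → IsChar (N i) (N (suc i)) (t i) (s i)) where

    open import Algebra.Properties.AbelianGroup +-abelianGroup using (xyx⁻¹≈y)
    open import Algebra.Properties.Group +-group using (x∙y⁻¹≈ε⇒x≈y; ∙-cancelˡ)
    open FiniteGroup using (^-card≈ε)

    private
      module Mₙ = Ring (matRing n)
      module Mₙ/N₁ = Ring (matRing n / matIdeal (N 1))

    ≡ᴹ[Nₖ]⇒≈ᴹ : ∀ {A B : Mat n} → A ≡ᴹ[ N k ] B → A ≈ᴹ B
    ≡ᴹ[Nₖ]⇒≈ᴹ A≡B i j = x∙y⁻¹≈ε⇒x≈y _ _ (Nₖ≈0 _ (A≡B i j))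

    ≈ᴹ⇒≡ᴹ : ∀ {i} {A B : Mat n} → A ≈ᴹ B → A ≡ᴹ[ N i ] B
    ≈ᴹ⇒≡ᴹ {i} = ≈⇒≈ᴵ (matRing n) (matIdeal (N i))

    ^-prod≡𝟙 : ∀ {X : Mat n} → X ≡ᴹ[ N 1 ] 𝟙 → ∀ j → suc j ≤ k → (X ^ᴹ prod1to s j) ≡ᴹ[ N (suc j) ] 𝟙
    ^-prod≡𝟙 {X} X≡𝟙 zero    _     = Mₙ/N₁.trans (≈ᴹ⇒≡ᴹ (⊗-identityʳ X)) X≡𝟙
    ^-prod≡𝟙 {X} X≡𝟙 (suc j) 2+j≤k =
      Ring.trans (matRing n / matIdeal (N (suc (suc j))))
        (≈ᴹ⇒≡ᴹ (Mₙ.sym (^ᴹ-*-assoc X (prod1to s j) (s (suc j)))))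
        (^-char≡𝟙 {J = N (suc (suc j))} (proj₁ (proj₂ (nilpotency (suc j) (s≤s z≤n) 2+j≤k)))
          (proj₁ (characteristic (suc j) (s≤s z≤n) 2+j≤k)) (^-prod≡𝟙 X≡𝟙 j (ℕ.<⇒≤ 2+j≤k)))

    ^-prod≈𝟙 : ∀ {X : Mat n} → X ≡ᴹ[ N 1 ] 𝟙 → (X ^ᴹ prod1to s (k ℕ.∸ 1)) ≈ᴹ 𝟙
    ^-prod≈𝟙 {X} X≡𝟙 =
      ≡ᴹ[Nₖ]⇒≈ᴹ (≡.subst (λ i → (X ^ᴹ prod1to s (k ℕ.∸ 1)) ≡ᴹ[ N i ] 𝟙) (ℕ.m+[n∸m]≡n 1≤k)
                  (^-prod≡𝟙 X≡𝟙 (k ℕ.∸ 1) (ℕ.≤-reflexive (ℕ.m+[n∸m]≡n 1≤k))))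

    prod1to-nonZero : ∀ j → j < k → ℕ.NonZero (prod1to s j)
    prod1to-nonZero zero    _     = _
    prod1to-nonZero (suc j) 1+j<k =
      ℕ.m*n≢0 (prod1to s j) (s (suc j)) {{prod1to-nonZero j (ℕ.<⇒≤ 1+j<k)}} {{ℕ.>-nonZero 0<s}}
      where
      0<s : 0 < s (suc j)
      0<s = proj₁ (proj₁ (characteristic (suc j) (s≤s z≤n) 1+j<k))

    ≡𝟙⇒unit : ∀ {X : Mat n} → X ≡ᴹ[ N 1 ] 𝟙 → IsUnitMod (N k) X
    ≡𝟙⇒unit {X} X≡𝟙 = ^ᴹ-suc≡𝟙⇒unit (N k) (ℕ.pred P)
      (≈ᴹ⇒≡ᴹ (≡.subst (λ e → (X ^ᴹ e) ≈ᴹ 𝟙) (≡.sym (ℕ.suc-pred P {{P≢0}})) (^-prod≈𝟙 X≡𝟙)))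
      where
      P : ℕ
      P = prod1to s (k ℕ.∸ 1)
      P≢0 : ℕ.NonZero P
      P≢0 = prod1to-nonZero (k ℕ.∸ 1) (ℕ.∸-monoʳ-< ℕ.z<s 1≤k)

    unit⇒unitMod : ∀ {i} {A : Mat n} → IsUnit A → IsUnitMod (N i) A
    unit⇒unitMod {i} = invertible-/ (matRing n) (matIdeal (N i))

    lift-exponent : ∀ w → (∀ (A : Mat n) → IsUnitMod (N 1) A → (A ^ᴹ w) ≡ᴹ[ N 1 ] 𝟙) →
                    ∀ (A : Mat n) → IsUnit A → (A ^ᴹ (w ℕ.* prod1to s (k ℕ.∸ 1))) ≈ᴹ 𝟙
    lift-exponent w exponent A A-unit =
      Mₙ.trans (Mₙ.sym (^ᴹ-*-assoc A w _)) (^-prod≈𝟙 (exponent A (unit⇒unitMod A-unit)))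

    ^-card≡𝟙 : ∀ {m} → HasCard (UnitsMod n (N 1)) (UEq (N 1)) m →
               ∀ (A : Mat n) → IsUnitMod (N 1) A → (A ^ᴹ m) ≡ᴹ[ N 1 ] 𝟙
    ^-card≡𝟙 {m} card A A-unit =
      ≡.subst (λ B → B ≡ᴹ[ N 1 ] 𝟙) (GL-^ (N 1) (A , A-unit) m) (^-card≈ε (GL (N 1)) card (A , A-unit))

    kernel : Group (c ⊔ p) p
    kernel = subgroup (GL (N k)) (λ g → proj₁ g ≡ᴹ[ N 1 ] 𝟙) Mₙ/N₁.refl ∙-closed ⁻¹-closed
      where
      ∙-closed : ∀ g h → proj₁ g ≡ᴹ[ N 1 ] 𝟙 → proj₁ h ≡ᴹ[ N 1 ] 𝟙 → (proj₁ g ⊗ proj₁ h) ≡ᴹ[ N 1 ] 𝟙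
      ∙-closed _ _ A≡𝟙 B≡𝟙 = Mₙ/N₁.trans (Mₙ/N₁.*-cong A≡𝟙 B≡𝟙) (Mₙ/N₁.*-identityˡ 𝟙)

      ⁻¹-closed : ∀ g → proj₁ g ≡ᴹ[ N 1 ] 𝟙 → proj₁ (Group._⁻¹ (GL (N k)) g) ≡ᴹ[ N 1 ] 𝟙
      ⁻¹-closed (A , B , _ , BA≡𝟙) A≡𝟙 = begin
        B     ≈⟨ Mₙ/N₁.*-identityʳ B ⟨
        B ⊗ 𝟙 ≈⟨ Mₙ/N₁.*-congˡ A≡𝟙 ⟨
        B ⊗ A ≈⟨ ≈ᴹ⇒≡ᴹ (≡ᴹ[Nₖ]⇒≈ᴹ BA≡𝟙) ⟩
        𝟙     ∎
        where open import Relation.Binary.Reasoning.Setoid Mₙ/N₁.setoid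

    kernel-^ : ∀ (g : Group.Carrier kernel) m →
               proj₁ (proj₁ (FiniteGroup._^_ kernel g m)) ≡ proj₁ (proj₁ g) ^ᴹ m
    kernel-^ g zero    = ≡.refl
    kernel-^ g (suc m) = ≡.cong (proj₁ (proj₁ g) ⊗_) (kernel-^ g m)

    kernel-card : ∀ {b} → HasCard (Elems (N 1)) (_≈E_ {I = N 1}) b →
                  HasCard (Group.Carrier kernel) (Group._≈_ kernel) (b ℕ.^ (n ℕ.* n))
    kernel-card {b} card =
      ≡.subst (HasCard (Group.Carrier kernel) (Group._≈_ kernel)) (ℕ.^-*-assoc b n n)
      (HasCard-map (Group.setoid kernel) 𝟙+_ 𝟙+-cong 𝟙+-injective 𝟙+-surjective
        (HasCard-Π (Pointwise (_≈E_ {I = N 1})) n (HasCard-Π (_≈E_ {I = N 1}) n card)))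
      where
      Entries : Set (c ⊔ p)
      Entries = Fin n → Fin n → Elems (N 1)

      𝟙+Y≡𝟙 : ∀ {Y : Mat n} → InMat (N 1) Y → (𝟙 +ᴹ Y) ≡ᴹ[ N 1 ] 𝟙
      𝟙+Y≡𝟙 {Y} Y∈N₁ i j = resp (N 1) (sym (xyx⁻¹≈y (𝟙 i j) (Y i j))) (Y∈N₁ i j)

      𝟙+_ : Entries → Group.Carrier kernel
      𝟙+ U = (𝟙 +ᴹ Y , ≡𝟙⇒unit (𝟙+Y≡𝟙 Y∈N₁)) , 𝟙+Y≡𝟙 Y∈N₁
        where
        Y : Mat n
        Y i j = proj₁ (U i j)
        Y∈N₁ : InMat (N 1) Y
        Y∈N₁ i j = proj₂ (U i j)

      𝟙+-cong : ∀ U V → Pointwise (Pointwise (_≈E_ {I = N 1})) U V → Group._≈_ kernel (𝟙+ U) (𝟙+ V)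
      𝟙+-cong U V U≈V = ≈ᴹ⇒≡ᴹ (λ i j → +-congˡ (U≈V i j))

      𝟙+-injective : ∀ U V → Group._≈_ kernel (𝟙+ U) (𝟙+ V) → Pointwise (Pointwise (_≈E_ {I = N 1})) U V
      𝟙+-injective U V 𝟙+U≡𝟙+V i j = ∙-cancelˡ (𝟙 i j) _ _ (≡ᴹ[Nₖ]⇒≈ᴹ 𝟙+U≡𝟙+V i j)

      𝟙+-surjective : ∀ g → ∃ λ U → Group._≈_ kernel (𝟙+ U) g
      𝟙+-surjective ((X , _) , X≡𝟙) = (λ i j → X i j - 𝟙 i j , X≡𝟙 i j) , ≈ᴹ⇒≡ᴹ λ i j →
        trans (sym (+-assoc (𝟙 i j) (X i j) (- 𝟙 i j))) (xyx⁻¹≈y (𝟙 i j) (X i j))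

    lift-exponent-via-kernel : ∀ {a b} → HasCard (UnitsMod n (N 1)) (UEq (N 1)) a →
      HasCard (Elems (N 1)) (_≈E_ {I = N 1}) b →
      ∀ (A : Mat n) → IsUnit A → (A ^ᴹ (a ℕ.* b ℕ.^ (n ℕ.* n))) ≈ᴹ 𝟙
    lift-exponent-via-kernel {a} {b} GL-card N₁-card A A-unit =
      Mₙ.trans (Mₙ.sym (^ᴹ-*-assoc A a (b ℕ.^ (n ℕ.* n)))) (≡ᴹ[Nₖ]⇒≈ᴹ [Aᵃ]ᴮ≡𝟙)
      where
      Aᵃ≡𝟙 : (A ^ᴹ a) ≡ᴹ[ N 1 ] 𝟙
      Aᵃ≡𝟙 = ^-card≡𝟙 GL-card A (unit⇒unitMod A-unit)
      Aᵃ : Group.Carrier kernel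
      Aᵃ = (A ^ᴹ a , ≡𝟙⇒unit Aᵃ≡𝟙) , Aᵃ≡𝟙
      [Aᵃ]ᴮ≡𝟙 : ((A ^ᴹ a) ^ᴹ (b ℕ.^ (n ℕ.* n))) ≡ᴹ[ N k ] 𝟙
      [Aᵃ]ᴮ≡𝟙 = ≡.subst (λ B → B ≡ᴹ[ N k ] 𝟙) (kernel-^ Aᵃ (b ℕ.^ (n ℕ.* n)))
                  (^-card≈ε kernel (kernel-card N₁-card) Aᵃ)

open import Data.Nat.Base using (_*_; _∸_; _^_)

-- Not used: N (suc i) ⊆I N i, the converse inclusion {0} ⊆ Nₖ, the minimality of tᵢ and sᵢ,
-- and, in (3), the cardinality of Mₙ(R)^*.
proposition4p2 : ∀ {c ℓ p} (R : CommutativeRing c ℓ) →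
  let open RingDefs R
  in (n k : ℕ) (N : ℕ → Ideal p) (t s : ℕ → ℕ) →
     1 ≤ k →
     (∀ x → mem (N k) x → IsZero x) →
     (∀ x → IsZero x → mem (N k) x) →
     (∀ i → 1 ≤ i → i < k → N (suc i) ⊆I N i) →
     (∀ i → 1 ≤ i → i < k → IsNilIndex (N i) (N (suc i)) (t i)) →
     (∀ i → 1 ≤ i → i < k → IsChar (N i) (N (suc i)) (t i) (s i)) →
     ((w : ℕ) →
        (∀ (A : Mat n) → IsUnitMod (N 1) A → (A ^ᴹ w) ≡ᴹ[ N 1 ] 𝟙) →
        ∀ (A : Mat n) → IsUnit A → (A ^ᴹ (w * prod1to s (k ∸ 1))) ≈ᴹ 𝟙)
     ×
     ((m : ℕ) → HasCard (UnitsMod n (N 1)) (UEq (N 1)) m →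
        ∀ (A : Mat n) → IsUnit A → (A ^ᴹ (m * prod1to s (k ∸ 1))) ≈ᴹ 𝟙)
     ×
     ((u a b : ℕ) → HasCard (Units n) _≈U_ u →
        HasCard (UnitsMod n (N 1)) (UEq (N 1)) a →
        HasCard (Elems (N 1)) (_≈E_ {I = N 1}) b →
        ∀ (A : Mat n) → IsUnit A → (A ^ᴹ (a * b ^ (n * n))) ≈ᴹ 𝟙)
proposition4p2 R n k N t s 1≤k Nₖ≈0 _ _ nilpotency characteristic =
  lift-exponent ,
  (λ m card → lift-exponent m (^-card≡𝟙 card)) ,
  (λ _ _ _ _ → lift-exponent-via-kernel)
  where open CNC R n k N t s 1≤k Nₖ≈0 nilpotency characteristic
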